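{- Let $G$ be a finite simple graph with $\gamma(G)=k$, and let $G'$ be the graph obtained from $G$ by adding one new vertex adjacent to all vertices of $G$ (a universal vertex). If there exists a free $k$-witness of $G$, then $\gamma(G')=k$; otherwise $\gamma(G')\le k+1$.
   Context: All graphs are finite, simple and undirected. A graph $G=(V,E)$ is a star-$k$-PCG if there exist a weight function $w:V\to\mathbb{R}^+$ and $k$ pairwise disjoint intervals $I_1,\dots,I_k$ such that for distinct $u,v\in V$, $uv\in E$ if and only if $w(u)+w(v)\in\bigcup_i I_i$; the weighted graph $G^w$ with these intervals is a $k$-witness. Intervals are $I_i=[a_i,b_i]$ with $b_i<a_{i+1}$. The star number $\gamma(G)$ is the least positive $k$ such that $G$ is a star-$k$-PCG. For distinct $u,v$, $w(uv)=w(u)+w(v)$. For $\gamma(G)=k$, a $k$-witness is left-free if every non-edge $e$ (pair of distinct non-adjacent vertices) satisfies $w(e)>b_1$, right-free if every non-edge $e$ satisfies $w(e)<a_k$, and free if it is left-free or right-free.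
   Formalization: The weights $w$ of every $k$-witness take positive rational values and its interval endpoints are rational, in place of positive real weights and real endpoints. -}

module Defs where

open import Data.Nat using (ℕ; zero; suc; _≤_; _<_)
open import Data.Fin using (Fin; toℕ)
import Data.Fin as F
open import Data.Bool using (Bool; true; false)
open import Data.Rational using (ℚ; 0ℚ; _+_) renaming (_≤_ to _≤ℚ_; _<_ to _<ℚ_)
open import Data.Product using (Σ; ∃; _×_; _,_)
open import Relation.Binary.PropositionalEquality using (_≡_; _≢_; refl)
open import Relation.Nullary using (¬_)
open import Function.Bundles using (_⇔_)

record Graph (n : ℕ) : Set where
  field
    adj   : Fin n → Fin n → Bool
    sym   : ∀ u v → adj u v ≡ adj v u
    irrefl : ∀ u → adj u u ≡ false

open Graph public

record Witness {n : ℕ} (G : Graph n) (k : ℕ) : Set where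
  field
    w      : Fin n → ℚ
    w-pos  : ∀ u → 0ℚ <ℚ w u
    a      : Fin k → ℚ
    b      : Fin k → ℚ
    a≤b    : ∀ i → a i ≤ℚ b i
    ordered : ∀ (i j : Fin k) → toℕ j ≡ suc (toℕ i) → b i <ℚ a j
    edge   : ∀ u v → u ≢ v →
               (adj G u v ≡ true) ⇔ (∃ λ i → (a i ≤ℚ (w u + w v)) × ((w u + w v) ≤ℚ b i))

open Witness public

StarPCG : {n : ℕ} → Graph n → ℕ → Set
StarPCG G k = Witness G k

StarNumber : {n : ℕ} → Graph n → ℕ → Set
StarNumber G k = (1 ≤ k) × StarPCG G k × (∀ m → 1 ≤ m → m < k → ¬ StarPCG G m)

LeftFree : {n k : ℕ} {G : Graph n} → Witness G k → Set
LeftFree {n} {k} {G} W = ∀ (i : Fin k) → toℕ i ≡ 0 →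
  ∀ (u v : Fin n) → u ≢ v → adj G u v ≡ false → b W i <ℚ (w W u + w W v)

RightFree : {n k : ℕ} {G : Graph n} → Witness G k → Set
RightFree {n} {k} {G} W = ∀ (i : Fin k) → suc (toℕ i) ≡ k →
  ∀ (u v : Fin n) → u ≢ v → adj G u v ≡ false → (w W u + w W v) <ℚ a W i

Free : {n k : ℕ} {G : Graph n} → Witness G k → Set
Free W = LeftFree W Data.Sum.⊎ RightFree W
  where import Data.Sum

addUniversal : {n : ℕ} → Graph n → Graph (suc n)
addUniversal {n} G = record { adj = A ; sym = S ; irrefl = I }
  where
    A : Fin (suc n) → Fin (suc n) → Bool
    A F.zero F.zero = false
    A F.zero (F.suc _) = true
    A (F.suc _) F.zero = true
    A (F.suc u) (F.suc v) = adj G u v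
    S : ∀ u v → A u v ≡ A v u
    S F.zero F.zero = refl
    S F.zero (F.suc _) = refl
    S (F.suc _) F.zero = refl
    S (F.suc u) (F.suc v) = sym G u v
    I : ∀ u → A u u ≡ false
    I F.zero = refl
    I (F.suc u) = irrefl G u

-- A left-free witness is shifted (every weight + M, every pair sum + 2M) and its first
-- interval is stretched down to 0; no non-edge sum lies below b₁, so nothing changes for G,
-- while the new vertex, of weight 1, now has all its pair sums in the first interval. A
-- right-free witness instead gets its last interval stretched upwards and the new vertex a
-- weight at least aₖ. Any witness turns into a left-free (k+1)-witness by prepending a
-- one-point interval below all pair sums, so γ(G') ≤ k + 1, and γ(G') ≥ k since G is an
-- induced subgraph of G'.
--
-- Constructively, choosing between γ(G') = k and γ(G') = k + 1 requires deciding whether G'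
-- is a star-k-PCG. A k-witness is a rational point satisfying a boolean combination of
-- strict and non-strict linear inequalities; putting it in disjunctive normal form and
-- running Fourier–Motzkin elimination on each conjunction decides this.

module Submission where

open import Defs

module LinearArithmetic where

  open import Data.Bool using (Bool; true; false; _∨_)
  open import Data.Empty using (⊥-elim)
  open import Data.Fin using (Fin; zero; suc)
  open import Data.List using (List; []; _∷_; _++_; map; cartesianProductWith)
  open import Data.List.Membership.Propositional using (_∈_)
  open import Data.List.Membership.Propositional.Properties
    using (∈-cartesianProductWith⁺; ∈-cartesianProductWith⁻)
  open import Data.List.Relation.Unary.All as All using (All; []; _∷_)
  import Data.List.Relation.Unary.All.Properties as Allₚ
  open import Data.List.Relation.Unary.Any as Any using (Any; here; there)
  import Data.List.Relation.Unary.Any.Properties as Anyₚ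
  open import Data.Nat using (ℕ; zero; suc)
  open import Data.Product using (∃; ∃₂; _×_; _,_; proj₂; uncurry)
  open import Data.Product.Function.NonDependent.Propositional using (_×-⇔_)
  open import Data.Rational using (ℚ; 0ℚ; 1ℚ; _+_; _*_; _-_; -_; 1/_; _<_; _≤_; positive)
  open import Data.Rational.Properties
  open import Data.Rational.Solver using (module +-*-Solver)
  open import Data.Sum using (_⊎_; inj₁; inj₂)
  open import Data.Sum.Function.Propositional using (_⊎-⇔_)
  open import Data.Vec.Functional as V using (Vector; head; tail)
  open import Function using (_∘_)
  open import Function.Bundles using (_⇔_; mk⇔; Equivalence)
  import Function.Properties.Equivalence as ⇔
  open import Level using (0ℓ)
  open import Relation.Binary.Definitions using (tri<; tri≈; tri>)
  open import Relation.Binary.PropositionalEquality using (_≡_; refl; cong; cong₂; subst; subst₂)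
  import Relation.Binary.PropositionalEquality as ≡
  import Relation.Binary.Reasoning.Setoid
  open import Relation.Nullary using (Dec; yes; no)
  open import Relation.Nullary.Decidable using (map′)
  open import Relation.Unary using (_⊆_)

  open +-*-Solver using (solve; _:+_; _:*_; :-_; _:-_; _:=_; con)
  open Equivalence using (to; from)

  infix 4 _<[_]_
  _<[_]_ : ℚ → Bool → ℚ → Set
  p <[ true  ] q = p < q
  p <[ false ] q = p ≤ q

  _<[_]?_ : ∀ p s q → Dec (p <[ s ] q)
  p <[ true  ]? q = p <? q
  p <[ false ]? q = p ≤? q

  <[]⇒≤ : ∀ s {p q} → p <[ s ] q → p ≤ q
  <[]⇒≤ true  = <⇒≤
  <[]⇒≤ false = λ p≤q → p≤q

  <⇒<[] : ∀ s {p q} → p < q → p <[ s ] q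
  <⇒<[] true  = λ p<q → p<q
  <⇒<[] false = <⇒≤

  <[]-trans : ∀ s t {p q r} → p <[ s ] q → q <[ t ] r → p <[ s ∨ t ] r
  <[]-trans true  t     p<q q≤r = <-≤-trans p<q (<[]⇒≤ t q≤r)
  <[]-trans false true  p≤q q<r = ≤-<-trans p≤q q<r
  <[]-trans false false p≤q q≤r = ≤-trans p≤q q≤r

  <[]-dense : ∀ s t {p q} → p <[ s ∨ t ] q → ∃ λ x → p <[ s ] x × x <[ t ] q
  <[]-dense true  t     p<q = let x , p<x , x<q = <-dense p<q in x , p<x , <⇒<[] t x<q
  <[]-dense false true  p<q = let x , p<x , x<q = <-dense p<q in x , <⇒≤ p<x , x<q
  <[]-dense false false {p} p≤q = p , ≤-refl , p≤q

  <[]-+ʳ-⇔ : ∀ s r {p q} → p <[ s ] q ⇔ p + r <[ s ] q + r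
  <[]-+ʳ-⇔ s r {p} {q} = mk⇔ (add s r) (subst₂ (_<[ s ]_) (p+r-r p) (p+r-r q) ∘ add s (- r))
    where
    add : ∀ s r {p q} → p <[ s ] q → p + r <[ s ] q + r
    add true  r = +-monoˡ-< r
    add false r = +-monoˡ-≤ r
    p+r-r : ∀ p → p + r - r ≡ p
    p+r-r p = solve 2 (λ p r → p :+ r :- r := p) refl p r

  <[]-*ˡ-⇔ : ∀ s {r} → 0ℚ < r → ∀ {p q} → p <[ s ] q ⇔ r * p <[ s ] r * q
  <[]-*ˡ-⇔ true  {r} r>0 = mk⇔ (*-monoʳ-<-pos r) (*-cancelˡ-<-nonNeg r)
    where instance _ = positive r>0 ; _ = pos⇒nonNeg r
  <[]-*ˡ-⇔ false {r} r>0 = mk⇔ (*-monoˡ-≤-nonNeg r) (*-cancelˡ-≤-pos r)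
    where instance _ = positive r>0 ; _ = pos⇒nonNeg r

  recip : ∀ r → 0ℚ < r → ℚ
  recip r r>0 = 1/ r
    where instance _ = pos⇒nonZero r {{positive r>0}}

  recip-pos : ∀ {r} (r>0 : 0ℚ < r) → 0ℚ < recip r r>0
  recip-pos {r} r>0 = positive⁻¹ (recip r r>0) {{1/pos⇒pos r}}
    where instance _ = positive r>0

  recip-inverseˡ : ∀ {r} (r>0 : 0ℚ < r) → recip r r>0 * r ≡ 1ℚ
  recip-inverseˡ {r} r>0 = *-inverseˡ r
    where instance _ = pos⇒nonZero r {{positive r>0}}

  module ⇔-Reasoning = Relation.Binary.Reasoning.Setoid (⇔.⇔-setoid 0ℓ)

  isolate-upper : ∀ s {a} (a>0 : 0ℚ < a) x t d →
    a * x + t <[ s ] d ⇔ x <[ s ] recip a a>0 * d - recip a a>0 * t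
  isolate-upper s {a} a>0 x t d = begin
    a * x + t <[ s ] d                   ≈⟨ <[]-+ʳ-⇔ s (- t) ⟩
    a * x + t - t <[ s ] d - t           ≡⟨ cong (_<[ s ] d - t) (solve 2 (λ y t → y :+ t :- t := y) refl (a * x) t) ⟩
    a * x <[ s ] d - t                   ≈⟨ <[]-*ˡ-⇔ s (recip-pos a>0) ⟩
    r * (a * x) <[ s ] r * (d - t)       ≡⟨ cong₂ (_<[ s ]_) r[ax]≡x (solve 3 (λ r d t → r :* (d :- t) := r :* d :- r :* t) refl r d t) ⟩
    x <[ s ] r * d - r * t               ∎
    where
    open ⇔-Reasoning
    r = recip a a>0
    r[ax]≡x : r * (a * x) ≡ x
    r[ax]≡x = ≡.trans (≡.sym (*-assoc r a x)) (≡.trans (cong (_* x) (recip-inverseˡ a>0)) (*-identityˡ x))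

  isolate-lower : ∀ s {a} (a<0 : a < 0ℚ) x t d →
    let r = recip (- a) (neg-antimono-< a<0) in a * x + t <[ s ] d ⇔ r * t - r * d <[ s ] x
  isolate-lower s {a} a<0 x t d = begin
    a * x + t <[ s ] d                             ≈⟨ <[]-*ˡ-⇔ s (recip-pos -a>0) ⟩
    r * (a * x + t) <[ s ] r * d                   ≡⟨ cong (_<[ s ] r * d) r[ax+t]≡-x+rt ⟩
    - x + r * t <[ s ] r * d                       ≈⟨ <[]-+ʳ-⇔ s (x - r * d) ⟩
    - x + r * t + (x - r * d) <[ s ] r * d + (x - r * d)
      ≡⟨ cong₂ (_<[ s ]_) (solve 3 (λ x p q → :- x :+ p :+ (x :- q) := p :- q) refl x (r * t) (r * d))
                          (solve 2 (λ q x → q :+ (x :- q) := x) refl (r * d) x) ⟩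
    r * t - r * d <[ s ] x                         ∎
    where
    open ⇔-Reasoning
    -a>0 = neg-antimono-< a<0
    r = recip (- a) -a>0
    r[ax+t]≡-x+rt : r * (a * x + t) ≡ - x + r * t
    r[ax+t]≡-x+rt = ≡.trans (solve 4 (λ r a x t → r :* (a :* x :+ t) := :- ((r :* (:- a)) :* x) :+ r :* t) refl r a x t)
                    (≡.trans (cong (λ y → - (y * x) + r * t) (recip-inverseˡ -a>0))
                             (cong (λ y → - y + r * t) (*-identityˡ x)))

  infixl 7 _·_
  _·_ : ∀ {m} → Vector ℚ m → Vector ℚ m → ℚ
  _·_ {zero}  c x = 0ℚ
  _·_ {suc m} c x = head c * head x + tail c · tail x

  ·-zipWith-+ : ∀ {m} (c d x : Vector ℚ m) → V.zipWith _+_ c d · x ≡ c · x + d · x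
  ·-zipWith-+ {zero}  c d x = ≡.sym (+-identityʳ 0ℚ)
  ·-zipWith-+ {suc m} c d x = ≡.trans (cong ((head c + head d) * head x +_) (·-zipWith-+ (tail c) (tail d) (tail x)))
    (solve 5 (λ c d x p q → (c :+ d) :* x :+ (p :+ q) := c :* x :+ p :+ (d :* x :+ q)) refl
             (head c) (head d) (head x) (tail c · tail x) (tail d · tail x))

  ·-zipWith-minus : ∀ {m} (c d x : Vector ℚ m) → V.zipWith _-_ c d · x ≡ c · x - d · x
  ·-zipWith-minus {zero}  c d x = ≡.sym (+-inverseʳ 0ℚ)
  ·-zipWith-minus {suc m} c d x = ≡.trans (cong ((head c - head d) * head x +_) (·-zipWith-minus (tail c) (tail d) (tail x)))
    (solve 5 (λ c d x p q → (c :- d) :* x :+ (p :- q) := c :* x :+ p :- (d :* x :+ q)) refl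
             (head c) (head d) (head x) (tail c · tail x) (tail d · tail x))

  ·-map-* : ∀ {m} r (c x : Vector ℚ m) → V.map (r *_) c · x ≡ r * (c · x)
  ·-map-* {zero}  r c x = ≡.sym (*-zeroʳ r)
  ·-map-* {suc m} r c x = ≡.trans (cong (r * head c * head x +_) (·-map-* r (tail c) (tail x)))
    (solve 4 (λ r c x p → r :* c :* x :+ r :* p := r :* (c :* x :+ p)) refl r (head c) (head x) (tail c · tail x))

  𝟘 : ∀ {m} → Vector ℚ m
  𝟘 _ = 0ℚ

  ·-𝟘 : ∀ {m} (x : Vector ℚ m) → 𝟘 · x ≡ 0ℚ
  ·-𝟘 {zero}  x = refl
  ·-𝟘 {suc m} x = ≡.trans (cong (0ℚ * head x +_) (·-𝟘 (tail x)))
    (≡.trans (+-identityʳ (0ℚ * head x)) (*-zeroˡ (head x)))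

  unit : ∀ {m} → Fin m → Vector ℚ m
  unit zero    = 1ℚ V.∷ 𝟘
  unit (suc i) = 0ℚ V.∷ unit i

  ·-unit : ∀ {m} (i : Fin m) (x : Vector ℚ m) → unit i · x ≡ x i
  ·-unit zero    x = ≡.trans (cong (1ℚ * head x +_) (·-𝟘 (tail x)))
    (≡.trans (+-identityʳ (1ℚ * head x)) (*-identityˡ (head x)))
  ·-unit (suc i) x = ≡.trans (cong (0ℚ * head x +_) (·-unit i (tail x)))
    (≡.trans (cong (_+ x (suc i)) (*-zeroˡ (head x))) (+-identityˡ (x (suc i))))

  Bound : Set
  Bound = ℚ × Bool

  Above Below : Bound → ℚ → Set
  Above (q , s) x = q <[ s ] x
  Below (q , s) x = x <[ s ] q

  Compatible : Bound → Bound → Set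
  Compatible (p , s) (q , t) = p <[ s ∨ t ] q

  Above-total : ∀ b c → Above b ⊆ Above c ⊎ Above c ⊆ Above b
  Above-total (p , s) (q , t) with <-cmp p q
  ... | tri< p<q _ _ = inj₂ λ q<x → <⇒<[] s (<-≤-trans p<q (<[]⇒≤ t q<x))
  ... | tri> _ _ q<p = inj₁ λ p<x → <⇒<[] t (<-≤-trans q<p (<[]⇒≤ s p<x))
  Above-total (p , true)  (p , t) | tri≈ _ refl _ = inj₁ (<⇒<[] t)
  Above-total (p , false) (p , t) | tri≈ _ refl _ = inj₂ (<[]⇒≤ t)

  Below-total : ∀ b c → Below b ⊆ Below c ⊎ Below c ⊆ Below b
  Below-total (p , s) (q , t) with <-cmp p q
  ... | tri< p<q _ _ = inj₁ λ x<p → <⇒<[] t (≤-<-trans (<[]⇒≤ s x<p) p<q)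
  ... | tri> _ _ q<p = inj₂ λ x<q → <⇒<[] s (≤-<-trans (<[]⇒≤ t x<q) q<p)
  Below-total (p , true)  (p , t) | tri≈ _ refl _ = inj₁ (<⇒<[] t)
  Below-total (p , false) (p , t) | tri≈ _ refl _ = inj₂ (<[]⇒≤ t)

  module _ {A : Set} (P : A → ℚ → Set) (total : ∀ a b → P a ⊆ P b ⊎ P b ⊆ P a) where

    tightest : ∀ a as → ∃ λ t → t ∈ a ∷ as × P t ⊆ (λ x → All (λ b → P b x) (a ∷ as))
    tightest a [] = a , here refl , (_∷ [])
    tightest a (b ∷ bs) with tightest b bs
    ... | t , t∈ , P[t]⇒all with total a t
    ...   | inj₁ a⊆t = a , here refl , λ pa → pa ∷ P[t]⇒all (a⊆t pa)
    ...   | inj₂ t⊆a = t , there t∈ , λ pt → t⊆a pt ∷ P[t]⇒all pt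

  p<p+q : ∀ p {q} → 0ℚ < q → p < p + q
  p<p+q p {q} q>0 = subst (_< p + q) (+-identityʳ p) (+-monoʳ-< p q>0)

  p-1<p : ∀ p → p - 1ℚ < p
  p-1<p p = subst (p - 1ℚ <_) (solve 1 (λ p → p :- con 1ℚ :+ con 1ℚ := p) refl p) (p<p+q (p - 1ℚ) (positive⁻¹ 1ℚ))

  between : {A B : Set} (lo : A → Bound) (hi : B → Bound) (L : List A) (U : List B) →
    (∀ {l u} → l ∈ L → u ∈ U → Compatible (lo l) (hi u)) →
    ∃ λ x → All (λ l → Above (lo l) x) L × All (λ u → Below (hi u) x) U
  between lo hi [] [] _ = 0ℚ , [] , []
  between lo hi [] (u ∷ us) _
    with tightest (Below ∘ hi) (λ a b → Below-total (hi a) (hi b)) u us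
  ... | t , _ , below⇒all = let q , s = hi t in q - 1ℚ , [] , below⇒all (<⇒<[] s (p-1<p q))
  between lo hi (l ∷ ls) [] _
    with tightest (Above ∘ lo) (λ a b → Above-total (lo a) (lo b)) l ls
  ... | t , _ , above⇒all = let q , s = lo t in q + 1ℚ , above⇒all (<⇒<[] s (p<p+q q (positive⁻¹ 1ℚ))) , []
  between lo hi (l ∷ ls) (u ∷ us) compatible
    with tightest (Above ∘ lo) (λ a b → Above-total (lo a) (lo b)) l ls
       | tightest (Below ∘ hi) (λ a b → Below-total (hi a) (hi b)) u us
  ... | tl , tl∈ , above⇒all | tu , tu∈ , below⇒all =
    let x , above , below = <[]-dense (proj₂ (lo tl)) (proj₂ (hi tu)) (compatible tl∈ tu∈)
    in x , above⇒all above , below⇒all below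

  record Constraint (m : ℕ) : Set where
    constructor constraint
    field
      coeffs : Vector ℚ m
      strict : Bool
      bound  : ℚ

  open Constraint

  infix 4 _⊨_
  _⊨_ : ∀ {m} → Vector ℚ m → Constraint m → Set
  x ⊨ c = coeffs c · x <[ strict c ] bound c

  lowerBound upperBound : ∀ {m} → Vector ℚ m → Constraint m → Bound
  lowerBound xs c = coeffs c · xs - bound c , strict c
  upperBound xs c = bound c - coeffs c · xs , strict c

  data Role (m : ℕ) : Set where
    free lower upper : Constraint m → Role m

  RoleSat : ∀ {m} → ℚ → Vector ℚ m → Role m → Set
  RoleSat x₀ xs (free c)  = xs ⊨ c
  RoleSat x₀ xs (lower c) = Above (lowerBound xs c) x₀
  RoleSat x₀ xs (upper c) = Below (upperBound xs c) x₀

  classify : ∀ {m} → Constraint (suc m) → Role m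
  classify (constraint c s d) with <-cmp (head c) 0ℚ
  ... | tri< c₀<0 _ _ = let r = recip (- head c) (neg-antimono-< c₀<0) in lower (constraint (V.map (r *_) (tail c)) s (r * d))
  ... | tri≈ _ _ _    = free (constraint (tail c) s d)
  ... | tri> _ _ c₀>0 = let r = recip (head c) c₀>0 in upper (constraint (V.map (r *_) (tail c)) s (r * d))

  classify-⇔ : ∀ {m} (c : Constraint (suc m)) x → x ⊨ c ⇔ RoleSat (head x) (tail x) (classify c)
  classify-⇔ (constraint c s d) x with <-cmp (head c) 0ℚ
  ... | tri< c₀<0 _ _ = subst (λ y → x ⊨ constraint c s d ⇔ y - r * d <[ s ] head x)
                                (≡.sym (·-map-* r (tail c) (tail x)))
                                (isolate-lower s c₀<0 (head x) (tail c · tail x) d)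
    where r = recip (- head c) (neg-antimono-< c₀<0)
  ... | tri≈ _ c₀≡0 _ = subst (λ y → x ⊨ constraint c s d ⇔ y <[ s ] d)
                                (≡.trans (cong (λ c₀ → c₀ * head x + tail c · tail x) c₀≡0)
                                         (≡.trans (cong (_+ tail c · tail x) (*-zeroˡ (head x))) (+-identityˡ _)))
                                ⇔.refl
  ... | tri> _ _ c₀>0 = subst (λ y → x ⊨ constraint c s d ⇔ head x <[ s ] r * d - y)
                                (≡.sym (·-map-* r (tail c) (tail x)))
                                (isolate-upper s c₀>0 (head x) (tail c · tail x) d)
    where r = recip (head c) c₀>0

  frees lowers uppers : ∀ {m} → List (Role m) → List (Constraint m)
  frees []             = []
  frees (free c ∷ rs)  = c ∷ frees rs
  frees (_ ∷ rs)       = frees rs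
  lowers []            = []
  lowers (lower c ∷ rs) = c ∷ lowers rs
  lowers (_ ∷ rs)      = lowers rs
  uppers []            = []
  uppers (upper c ∷ rs) = c ∷ uppers rs
  uppers (_ ∷ rs)      = uppers rs

  SortedSat : ∀ {m} → ℚ → Vector ℚ m → List (Role m) → Set
  SortedSat x₀ xs rs = All (xs ⊨_) (frees rs)
                     × All (λ c → Above (lowerBound xs c) x₀) (lowers rs)
                     × All (λ c → Below (upperBound xs c) x₀) (uppers rs)

  All-RoleSat-⇔ : ∀ {m} x₀ (xs : Vector ℚ m) rs → All (RoleSat x₀ xs) rs ⇔ SortedSat x₀ xs rs
  All-RoleSat-⇔ x₀ xs rs = mk⇔ (sort rs) (unsort rs)
    where
    sort : ∀ rs → All (RoleSat x₀ xs) rs → SortedSat x₀ xs rs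
    sort []              []       = [] , [] , []
    sort (free c ∷ rs)   (p ∷ ps) = let f , l , u = sort rs ps in p ∷ f , l , u
    sort (lower c ∷ rs)  (p ∷ ps) = let f , l , u = sort rs ps in f , p ∷ l , u
    sort (upper c ∷ rs)  (p ∷ ps) = let f , l , u = sort rs ps in f , l , p ∷ u
    unsort : ∀ rs → SortedSat x₀ xs rs → All (RoleSat x₀ xs) rs
    unsort []             _                = []
    unsort (free c ∷ rs)  (p ∷ f , l , u)  = p ∷ unsort rs (f , l , u)
    unsort (lower c ∷ rs) (f , p ∷ l , u)  = p ∷ unsort rs (f , l , u)
    unsort (upper c ∷ rs) (f , l , p ∷ u)  = p ∷ unsort rs (f , l , u)

  combine : ∀ {m} → Constraint m → Constraint m → Constraint m
  combine l u = constraint (V.zipWith _+_ (coeffs l) (coeffs u)) (strict l ∨ strict u) (bound l + bound u)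

  combine-⇔ : ∀ {m} (xs : Vector ℚ m) l u → xs ⊨ combine l u ⇔ Compatible (lowerBound xs l) (upperBound xs u)
  combine-⇔ xs l u = begin
    xs ⊨ combine l u                  ≡⟨ cong (_<[ s ]  bound l + bound u) (·-zipWith-+ (coeffs l) (coeffs u) xs) ⟩
    p + q <[ s ] bound l + bound u    ≈⟨ <[]-+ʳ-⇔ s (- bound l - q) ⟩
    p + q + (- bound l - q) <[ s ] bound l + bound u + (- bound l - q)
      ≡⟨ cong₂ (_<[ s ]_) (solve 3 (λ p q d → p :+ q :+ (:- d :- q) := p :- d) refl p q (bound l))
                          (solve 3 (λ d e q → d :+ e :+ (:- d :- q) := e :- q) refl (bound l) (bound u) q) ⟩
    Compatible (lowerBound xs l) (upperBound xs u) ∎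
    where
    open ⇔-Reasoning
    s = strict l ∨ strict u
    p = coeffs l · xs
    q = coeffs u · xs

  All-cartesianProductWith-⇔ : {A B C : Set} {P : C → Set} (f : A → B → C) (xs : List A) (ys : List B) →
    All P (cartesianProductWith f xs ys) ⇔ (∀ {x y} → x ∈ xs → y ∈ ys → P (f x y))
  All-cartesianProductWith-⇔ {P = P} f xs ys = mk⇔ lookup tabulate
    where
    Pairwise = ∀ {x y} → x ∈ xs → y ∈ ys → P (f x y)
    lookup : All P (cartesianProductWith f xs ys) → Pairwise
    lookup all x∈ y∈ = All.lookup all (∈-cartesianProductWith⁺ f x∈ y∈)
    at : ∀ {v} → Pairwise → (∃₂ λ x y → x ∈ xs × y ∈ ys × v ≡ f x y) → P v
    at pairwise (x , y , x∈ , y∈ , refl) = pairwise x∈ y∈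
    tabulate : Pairwise → All P (cartesianProductWith f xs ys)
    tabulate pairwise = All.tabulate (λ v∈ → at pairwise (∈-cartesianProductWith⁻ f xs ys v∈))

  eliminate : ∀ {m} → List (Constraint (suc m)) → List (Constraint m)
  eliminate cs = frees rs ++ cartesianProductWith combine (lowers rs) (uppers rs)
    where rs = map classify cs

  classify-All-⇔ : ∀ {m} (cs : List (Constraint (suc m))) x →
    All (x ⊨_) cs ⇔ SortedSat (head x) (tail x) (map classify cs)
  classify-All-⇔ cs x = ⇔.trans
    (mk⇔ (Allₚ.map⁺ ∘ All.map (λ {c} → to (classify-⇔ c x))) (All.map (λ {c} → from (classify-⇔ c x)) ∘ Allₚ.map⁻))
    (All-RoleSat-⇔ (head x) (tail x) (map classify cs))

  eliminate-sound : ∀ {m} (cs : List (Constraint (suc m))) x → All (x ⊨_) cs → All (tail x ⊨_) (eliminate cs)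
  eliminate-sound cs x sat =
    let f , l , u = to (classify-All-⇔ cs x) sat
    in Allₚ.++⁺ f (from (All-cartesianProductWith-⇔ combine _ _) λ {c} {d} c∈ d∈ →
         from (combine-⇔ (tail x) c d) (<[]-trans (strict c) (strict d) (All.lookup l c∈) (All.lookup u d∈)))

  eliminate-complete : ∀ {m} (cs : List (Constraint (suc m))) xs →
    All (xs ⊨_) (eliminate cs) → ∃ λ x₀ → All ((x₀ V.∷ xs) ⊨_) cs
  eliminate-complete cs xs sat =
    let rs = map classify cs
        f , pairs = Allₚ.++⁻ (frees rs) sat
        x₀ , l , u = between (lowerBound xs) (upperBound xs) (lowers rs) (uppers rs)
                       (λ {c} {d} c∈ d∈ → to (combine-⇔ xs c d) (to (All-cartesianProductWith-⇔ combine _ _) pairs c∈ d∈))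
    in x₀ , from (classify-All-⇔ cs (x₀ V.∷ xs)) (f , l , u)

  satisfiable? : ∀ {m} (cs : List (Constraint m)) → Dec (∃ λ x → All (x ⊨_) cs)
  satisfiable? {zero}  cs = map′ (λ sat → (λ ()) , sat) proj₂ (All.all? (λ c → 0ℚ <[ strict c ]? bound c) cs)
  satisfiable? {suc m} cs = map′
    (λ (xs , sat) → let x₀ , sat′ = eliminate-complete cs xs sat in x₀ V.∷ xs , sat′)
    (λ (x , sat) → tail x , eliminate-sound cs x sat)
    (satisfiable? (eliminate cs))

  infix 5 _≺[_]_
  _≺[_]_ : ∀ {m} → Vector ℚ m → Bool → Vector ℚ m → Constraint m
  P ≺[ s ] Q = constraint (V.zipWith _-_ P Q) s 0ℚ

  ⊨-≺ : ∀ {m} (x P : Vector ℚ m) s Q → x ⊨ P ≺[ s ] Q ⇔ P · x <[ s ] Q · x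
  ⊨-≺ x P s Q = begin
    x ⊨ P ≺[ s ] Q                     ≡⟨ cong (_<[ s ] 0ℚ) (·-zipWith-minus P Q x) ⟩
    P · x - Q · x <[ s ] 0ℚ            ≈⟨ <[]-+ʳ-⇔ s (Q · x) ⟩
    P · x - Q · x + Q · x <[ s ] 0ℚ + Q · x
      ≡⟨ cong₂ (_<[ s ]_) (solve 2 (λ p q → p :- q :+ q := p) refl (P · x) (Q · x)) (+-identityˡ (Q · x)) ⟩
    P · x <[ s ] Q · x                 ∎
    where open ⇔-Reasoning

  Dnf : ℕ → Set
  Dnf m = List (List (Constraint m))

  infix 4 _⊨ᴰ_
  _⊨ᴰ_ : ∀ {m} → Vector ℚ m → Dnf m → Set
  x ⊨ᴰ D = Any (All (x ⊨_)) D

  ⟨_⟩ : ∀ {m} → Constraint m → Dnf m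
  ⟨ c ⟩ = (c ∷ []) ∷ []

  ⊤ᴰ ⊥ᴰ : ∀ {m} → Dnf m
  ⊤ᴰ = [] ∷ []
  ⊥ᴰ = []

  infixr 6 _∧ᴰ_
  infixr 5 _∨ᴰ_
  _∧ᴰ_ _∨ᴰ_ : ∀ {m} → Dnf m → Dnf m → Dnf m
  _∧ᴰ_ = cartesianProductWith _++_
  _∨ᴰ_ = _++_

  ⋀ᴰ ⋁ᴰ : ∀ {m N} → (Fin N → Dnf m) → Dnf m
  ⋀ᴰ {N = zero}  D = ⊤ᴰ
  ⋀ᴰ {N = suc N} D = D zero ∧ᴰ ⋀ᴰ (D ∘ suc)
  ⋁ᴰ {N = zero}  D = ⊥ᴰ
  ⋁ᴰ {N = suc N} D = D zero ∨ᴰ ⋁ᴰ (D ∘ suc)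

  when : ∀ {m} {P : Set} → Dec P → Dnf m → Dnf m
  when (yes _) D = D
  when (no _)  D = ⊤ᴰ

  module _ {m} (x : Vector ℚ m) where

    ⊨ᴰ-⟨⟩ : ∀ c → x ⊨ᴰ ⟨ c ⟩ ⇔ x ⊨ c
    ⊨ᴰ-⟨⟩ c = mk⇔ (λ { (here (sat ∷ [])) → sat }) (λ sat → here (sat ∷ []))

    ⊨ᴰ-∧ᴰ : ∀ {D E} {P Q : Set} → x ⊨ᴰ D ⇔ P → x ⊨ᴰ E ⇔ Q → x ⊨ᴰ D ∧ᴰ E ⇔ (P × Q)
    ⊨ᴰ-∧ᴰ {D} {E} D⇔P E⇔Q = ⇔.trans
      (mk⇔ (Anyₚ.cartesianProductWith⁻ _++_ (λ {cs} → Allₚ.++⁻ cs) D E)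
           (uncurry (Anyₚ.cartesianProductWith⁺ _++_ Allₚ.++⁺)))
      (D⇔P ×-⇔ E⇔Q)

    ⊨ᴰ-∨ᴰ : ∀ {D E} {P Q : Set} → x ⊨ᴰ D ⇔ P → x ⊨ᴰ E ⇔ Q → x ⊨ᴰ D ∨ᴰ E ⇔ (P ⊎ Q)
    ⊨ᴰ-∨ᴰ {D} D⇔P E⇔Q = ⇔.trans
      (mk⇔ (Anyₚ.++⁻ D) λ { (inj₁ sat) → Anyₚ.++⁺ˡ sat ; (inj₂ sat) → Anyₚ.++⁺ʳ D sat })
      (D⇔P ⊎-⇔ E⇔Q)

    ⊨ᴰ-⋀ᴰ : ∀ {N} {D : Fin N → Dnf m} {P : Fin N → Set} → (∀ i → x ⊨ᴰ D i ⇔ P i) → x ⊨ᴰ ⋀ᴰ D ⇔ (∀ i → P i)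
    ⊨ᴰ-⋀ᴰ {zero}  _   = mk⇔ (λ _ ()) (λ _ → here [])
    ⊨ᴰ-⋀ᴰ {suc N} D⇔P = ⇔.trans (⊨ᴰ-∧ᴰ (D⇔P zero) (⊨ᴰ-⋀ᴰ (D⇔P ∘ suc)))
      (mk⇔ (λ { (p₀ , p) zero → p₀ ; (p₀ , p) (suc i) → p i }) (λ p → p zero , p ∘ suc))

    ⊨ᴰ-⋁ᴰ : ∀ {N} {D : Fin N → Dnf m} {P : Fin N → Set} → (∀ i → x ⊨ᴰ D i ⇔ P i) → x ⊨ᴰ ⋁ᴰ D ⇔ ∃ P
    ⊨ᴰ-⋁ᴰ {zero}  _   = mk⇔ (λ ()) (λ ())
    ⊨ᴰ-⋁ᴰ {suc N} D⇔P = ⇔.trans (⊨ᴰ-∨ᴰ (D⇔P zero) (⊨ᴰ-⋁ᴰ (D⇔P ∘ suc)))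
      (mk⇔ (λ { (inj₁ p) → zero , p ; (inj₂ (i , p)) → suc i , p })
           (λ { (zero , p) → inj₁ p ; (suc i , p) → inj₂ (i , p) }))

    ⊨ᴰ-when : ∀ {P Q : Set} (p? : Dec P) {D} → x ⊨ᴰ D ⇔ Q → x ⊨ᴰ when p? D ⇔ (P → Q)
    ⊨ᴰ-when (yes p) D⇔Q = ⇔.trans D⇔Q (mk⇔ (λ q _ → q) (λ q → q p))
    ⊨ᴰ-when (no ¬p) _   = mk⇔ (λ _ p → ⊥-elim (¬p p)) (λ _ → here [])

  satisfiableᴰ? : ∀ {m} (D : Dnf m) → Dec (∃ λ x → x ⊨ᴰ D)
  satisfiableᴰ? D = map′ pull (λ (x , sat) → Any.map (x ,_) sat) (Any.any? satisfiable? D)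
    where
    pull : ∀ {D} → Any (λ cs → ∃ λ x → All (x ⊨_) cs) D → ∃ λ x → x ⊨ᴰ D
    pull (here (x , sat)) = x , here sat
    pull (there sat)      = let x , sat′ = pull sat in x , there sat′

module Witnesses where

  open import Data.Bool using (true; false; if_then_else_)
  open import Data.Bool.Properties using (¬-not)
  open import Data.Empty using (⊥-elim)
  open import Data.Fin as Fin using (Fin; zero; suc; toℕ; _↑ˡ_; _↑ʳ_)
  import Data.Fin.Properties as Finₚ
  open import Data.Nat as ℕ using (ℕ; zero; suc)
  import Data.Nat.Properties as ℕₚ
  open import Data.Product using (∃; _×_; _,_; proj₁; proj₂)
  open import Data.Rational using (ℚ; 0ℚ; 1ℚ; _+_; _-_; _<_; _≤_; _⊔_; _⊓_)
  open import Data.Rational.Properties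
  open import Data.Rational.Solver using (module +-*-Solver)
  open import Data.Sum using (_⊎_; inj₁; inj₂)
  open import Data.Vec.Functional as V using (Vector)
  import Data.Vec.Functional.Properties as Vₚ
  open import Function using (_∘_; case_of_)
  open import Function.Bundles using (_⇔_; mk⇔; Equivalence)
  import Function.Properties.Equivalence as ⇔
  open import Relation.Binary.PropositionalEquality using (_≡_; _≢_; refl; cong; cong₂; subst)
  import Relation.Binary.PropositionalEquality as ≡
  open import Relation.Nullary using (¬_; ¬?; Dec; yes; no)
  open import Relation.Nullary.Decidable using (map′)

  open +-*-Solver using (solve; _:+_; _:-_; _:=_; con)
  open Equivalence using (to; from)
  open LinearArithmetic

  InIntervals : ∀ {k} → (Fin k → ℚ) → (Fin k → ℚ) → ℚ → Set
  InIntervals a b s = ∃ λ i → a i ≤ s × s ≤ b i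

  InIntervals-+ʳ-⇔ : ∀ {k} (a b : Fin k → ℚ) s r → InIntervals a b s ⇔ InIntervals (λ i → a i + r) (λ i → b i + r) (s + r)
  InIntervals-+ʳ-⇔ a b s r = mk⇔
    (λ (i , a≤s , s≤b) → i , to (<[]-+ʳ-⇔ false r) a≤s , to (<[]-+ʳ-⇔ false r) s≤b)
    (λ (i , a≤s , s≤b) → i , from (<[]-+ʳ-⇔ false r) a≤s , from (<[]-+ʳ-⇔ false r) s≤b)

  pairSum-shift : ∀ x y M → x + y + (M + M) ≡ (x + M) + (y + M)
  pairSum-shift = solve 3 (λ x y m → x :+ y :+ (m :+ m) := (x :+ m) :+ (y :+ m)) refl

  outside-⇔ : ∀ {a b s} → (s < a ⊎ b < s) ⇔ (¬ (a ≤ s × s ≤ b))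
  outside-⇔ {a} {b} {s} = mk⇔ outside⇒¬inside ¬inside⇒outside
    where
    outside⇒¬inside : s < a ⊎ b < s → ¬ (a ≤ s × s ≤ b)
    outside⇒¬inside (inj₁ s<a) (a≤s , _)   = <-irrefl refl (<-≤-trans s<a a≤s)
    outside⇒¬inside (inj₂ b<s) (_   , s≤b) = <-irrefl refl (<-≤-trans b<s s≤b)
    ¬inside⇒outside : ¬ (a ≤ s × s ≤ b) → s < a ⊎ b < s
    ¬inside⇒outside ¬inside with s <? a | b <? s
    ... | yes s<a | _       = inj₁ s<a
    ... | no _    | yes b<s = inj₂ b<s
    ... | no s≮a  | no b≮s  = ⊥-elim (¬inside (≮⇒≥ s≮a , ≮⇒≥ b≮s))

  WitnessConditions : ∀ {n k} → Graph n → (Fin n → ℚ) → (Fin k → ℚ) → (Fin k → ℚ) → Set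
  WitnessConditions G w a b =
      (∀ u → 0ℚ < w u)
    × (∀ i → a i ≤ b i)
    × (∀ i j → toℕ j ≡ suc (toℕ i) → b i < a j)
    × (∀ u v → u ≢ v → (adj G u v ≡ true) ⇔ InIntervals a b (w u + w v))

  conditions⇒witness : ∀ {n k} {G : Graph n} {w a b} → WitnessConditions G w a b → Witness G k
  conditions⇒witness {w = w} {a} {b} (w-pos , a≤b , ordered , edge) = record
    { w = w ; w-pos = w-pos ; a = a ; b = b ; a≤b = a≤b ; ordered = ordered ; edge = edge }

  witness⇒conditions : ∀ {n k} {G : Graph n} (W : Witness G k) → WitnessConditions G (w W) (a W) (b W)
  witness⇒conditions W = w-pos W , a≤b W , ordered W , edge W

  module WitnessEncoding {n : ℕ} (G : Graph n) (k : ℕ) where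

    dim : ℕ
    dim = n ℕ.+ (k ℕ.+ k)

    weightVar : Fin n → Fin dim
    weightVar u = u ↑ˡ (k ℕ.+ k)

    leftVar rightVar : Fin k → Fin dim
    leftVar  i = n ↑ʳ (i ↑ˡ k)
    rightVar i = n ↑ʳ (k ↑ʳ i)

    𝐰 : Fin n → Vector ℚ dim
    𝐰 u = unit (weightVar u)

    𝐚 𝐛 : Fin k → Vector ℚ dim
    𝐚 i = unit (leftVar i)
    𝐛 i = unit (rightVar i)

    𝐰₂ : Fin n → Fin n → Vector ℚ dim
    𝐰₂ u v = V.zipWith _+_ (𝐰 u) (𝐰 v)

    insideᴰ outsideᴰ : Fin n → Fin n → Fin k → Dnf dim
    insideᴰ  u v i = ⟨ 𝐚 i ≺[ false ] 𝐰₂ u v ⟩ ∧ᴰ ⟨ 𝐰₂ u v ≺[ false ] 𝐛 i ⟩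
    outsideᴰ u v i = ⟨ 𝐰₂ u v ≺[ true ] 𝐚 i ⟩ ∨ᴰ ⟨ 𝐛 i ≺[ true ] 𝐰₂ u v ⟩

    edgeᴰ : Fin n → Fin n → Dnf dim
    edgeᴰ u v = if adj G u v then ⋁ᴰ (insideᴰ u v) else ⋀ᴰ (outsideᴰ u v)

    witnessᴰ : Dnf dim
    witnessᴰ = (⋀ᴰ λ u → ⟨ 𝟘 ≺[ true ] 𝐰 u ⟩)
            ∧ᴰ (⋀ᴰ λ i → ⟨ 𝐚 i ≺[ false ] 𝐛 i ⟩)
            ∧ᴰ (⋀ᴰ λ i → ⋀ᴰ λ j → when (toℕ j ℕ.≟ suc (toℕ i)) ⟨ 𝐛 i ≺[ true ] 𝐚 j ⟩)
            ∧ᴰ (⋀ᴰ λ u → ⋀ᴰ λ v → when (¬? (u Fin.≟ v)) (edgeᴰ u v))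

    -- Stated for any (w, a, b) that x agrees with pointwise, so that it serves both to decode
    -- a solution x and to encode a given witness.
    module _ (x : Vector ℚ dim) (w : Fin n → ℚ) (a b : Fin k → ℚ)
             (x-w : ∀ u → x (weightVar u) ≡ w u)
             (x-a : ∀ i → x (leftVar i) ≡ a i)
             (x-b : ∀ i → x (rightVar i) ≡ b i) where

      𝐰-· : ∀ u → 𝐰 u · x ≡ w u
      𝐰-· u = ≡.trans (·-unit (weightVar u) x) (x-w u)

      𝐚-· : ∀ i → 𝐚 i · x ≡ a i
      𝐚-· i = ≡.trans (·-unit (leftVar i) x) (x-a i)

      𝐛-· : ∀ i → 𝐛 i · x ≡ b i
      𝐛-· i = ≡.trans (·-unit (rightVar i) x) (x-b i)

      𝐰₂-· : ∀ u v → 𝐰₂ u v · x ≡ w u + w v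
      𝐰₂-· u v = ≡.trans (·-zipWith-+ (𝐰 u) (𝐰 v) x) (cong₂ _+_ (𝐰-· u) (𝐰-· v))

      ⊨ᴰ-≺ : ∀ {P Q p q} s → P · x ≡ p → Q · x ≡ q → x ⊨ᴰ ⟨ P ≺[ s ] Q ⟩ ⇔ p <[ s ] q
      ⊨ᴰ-≺ {P} {Q} s P≡p Q≡q =
        ⇔.trans (⊨ᴰ-⟨⟩ x (P ≺[ s ] Q)) (⇔.trans (⊨-≺ x P s Q) (≡.subst₂ (λ p q → (P · x <[ s ] Q · x) ⇔ (p <[ s ] q)) P≡p Q≡q ⇔.refl))

      edge-⇔ : ∀ u v → x ⊨ᴰ edgeᴰ u v ⇔ ((adj G u v ≡ true) ⇔ InIntervals a b (w u + w v))
      edge-⇔ u v with adj G u v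
      ... | true  = ⇔.trans (⊨ᴰ-⋁ᴰ x λ i → ⊨ᴰ-∧ᴰ x (⊨ᴰ-≺ false (𝐚-· i) (𝐰₂-· u v)) (⊨ᴰ-≺ false (𝐰₂-· u v) (𝐛-· i)))
                            (mk⇔ (λ inside → mk⇔ (λ _ → inside) (λ _ → refl)) (λ edge⇔ → to edge⇔ refl))
      ... | false = ⇔.trans (⊨ᴰ-⋀ᴰ x λ i → ⇔.trans (⊨ᴰ-∨ᴰ x (⊨ᴰ-≺ true (𝐰₂-· u v) (𝐚-· i)) (⊨ᴰ-≺ true (𝐛-· i) (𝐰₂-· u v))) outside-⇔)
                            (mk⇔ (λ outside → mk⇔ (λ ()) (λ (i , inside) → ⊥-elim (outside i inside)))
                                 (λ edge⇔ i inside → false≢true (from edge⇔ (i , inside))))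
        where
        false≢true : false ≢ true
        false≢true ()

      witness-⇔ : x ⊨ᴰ witnessᴰ ⇔ WitnessConditions G w a b
      witness-⇔ =
        ⊨ᴰ-∧ᴰ x (⊨ᴰ-⋀ᴰ x λ u → ⊨ᴰ-≺ true (·-𝟘 x) (𝐰-· u))
       (⊨ᴰ-∧ᴰ x (⊨ᴰ-⋀ᴰ x λ i → ⊨ᴰ-≺ false (𝐚-· i) (𝐛-· i))
       (⊨ᴰ-∧ᴰ x (⊨ᴰ-⋀ᴰ x λ i → ⊨ᴰ-⋀ᴰ x λ j → ⊨ᴰ-when x (toℕ j ℕ.≟ suc (toℕ i)) (⊨ᴰ-≺ true (𝐛-· i) (𝐚-· j)))
                (⊨ᴰ-⋀ᴰ x λ u → ⊨ᴰ-⋀ᴰ x λ v → ⊨ᴰ-when x (¬? (u Fin.≟ v)) (edge-⇔ u v))))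

    starPCG? : Dec (StarPCG G k)
    starPCG? = map′ decode encode (satisfiableᴰ? witnessᴰ)
      where
      decode : (∃ λ x → x ⊨ᴰ witnessᴰ) → Witness G k
      decode (x , sat) = conditions⇒witness
        (to (witness-⇔ x (x ∘ weightVar) (x ∘ leftVar) (x ∘ rightVar) (λ _ → refl) (λ _ → refl) (λ _ → refl)) sat)
      encode : Witness G k → ∃ λ x → x ⊨ᴰ witnessᴰ
      encode W = x , from (witness-⇔ x (w W) (a W) (b W) x-w x-a x-b) (witness⇒conditions W)
        where
        x : Vector ℚ dim
        x = w W V.++ (a W V.++ b W)
        x-w : ∀ u → x (weightVar u) ≡ w W u
        x-w = Vₚ.lookup-++ˡ (w W) (a W V.++ b W)
        x-a : ∀ i → x (leftVar i) ≡ a W i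
        x-a i = ≡.trans (Vₚ.lookup-++ʳ (w W) (a W V.++ b W) (i ↑ˡ k)) (Vₚ.lookup-++ˡ (a W) (b W) i)
        x-b : ∀ i → x (rightVar i) ≡ b W i
        x-b i = ≡.trans (Vₚ.lookup-++ʳ (w W) (a W V.++ b W) (k ↑ʳ i)) (Vₚ.lookup-++ʳ (a W) (b W) i)

  boundedAbove : ∀ {n} (f : Fin n → ℚ) → ∃ λ B → ∀ i → f i ≤ B
  boundedAbove {zero}  f = 0ℚ , λ ()
  boundedAbove {suc n} f =
    let B , f≤B = boundedAbove (f ∘ suc)
    in f zero ⊔ B , λ { zero → p≤p⊔q (f zero) B ; (suc i) → p≤q⇒p≤r⊔q (f zero) (f≤B i) }

  module _ {n : ℕ} {G : Graph n} where

    pairSum-pos : ∀ {k} (W : Witness G k) u v → 0ℚ < w W u + w W v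
    pairSum-pos W u v = +-mono-< (w-pos W u) (w-pos W v)

    restrict : ∀ {k} → Witness (addUniversal G) k → Witness G k
    restrict W = record
      { w = w W ∘ suc ; w-pos = w-pos W ∘ suc ; a = a W ; b = b W ; a≤b = a≤b W ; ordered = ordered W
      ; edge = λ u v u≢v → edge W (suc u) (suc v) (u≢v ∘ Finₚ.suc-injective) }

    universal-extend : ∀ {k} (W : Witness G k) t → 0ℚ < t →
      (∀ u → InIntervals (a W) (b W) (t + w W u)) → Witness (addUniversal G) k
    universal-extend W t t>0 covered = record
      { w = t V.∷ w W ; w-pos = λ { zero → t>0 ; (suc u) → w-pos W u }
      ; a = a W ; b = b W ; a≤b = a≤b W ; ordered = ordered W ; edge = edge′ }
      where
      edge′ : ∀ u v → u ≢ v → (adj (addUniversal G) u v ≡ true) ⇔ InIntervals (a W) (b W) ((t V.∷ w W) u + (t V.∷ w W) v)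
      edge′ zero    zero    u≢v = ⊥-elim (u≢v refl)
      edge′ zero    (suc v) _   = mk⇔ (λ _ → covered v) (λ _ → refl)
      edge′ (suc u) zero    _   = mk⇔ (λ _ → subst (InIntervals (a W) (b W)) (+-comm t (w W u)) (covered u)) (λ _ → refl)
      edge′ (suc u) (suc v) u≢v = edge W u v (u≢v ∘ cong suc)

    shift : ∀ {k} (W : Witness G k) M → 0ℚ ≤ M → Witness G k
    shift W M M≥0 = record
      { w = w′ ; w-pos = λ u → +-mono-<-≤ (w-pos W u) M≥0
      ; a = a′ ; b = b′
      ; a≤b = λ i → +-monoˡ-≤ (M + M) (a≤b W i)
      ; ordered = λ i j j≡1+i → +-monoˡ-< (M + M) (ordered W i j j≡1+i)
      ; edge = edge′
      }
      where
      w′ = λ u → w W u + M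
      a′ = λ i → a W i + (M + M)
      b′ = λ i → b W i + (M + M)
      edge′ : ∀ u v → u ≢ v → (adj G u v ≡ true) ⇔ InIntervals a′ b′ (w′ u + w′ v)
      edge′ u v u≢v = ⇔.trans (edge W u v u≢v) (⇔.trans (InIntervals-+ʳ-⇔ (a W) (b W) (w W u + w W v) (M + M))
        (subst (λ s → InIntervals a′ b′ (w W u + w W v + (M + M)) ⇔ InIntervals a′ b′ s)
               (pairSum-shift (w W u) (w W v) M) ⇔.refl))

    shift-leftFree : ∀ {k} (W : Witness G k) M (M≥0 : 0ℚ ≤ M) → LeftFree W → LeftFree (shift W M M≥0)
    shift-leftFree W M M≥0 leftFree i i≡0 u v u≢v nonadjacent =
      subst (b W i + (M + M) <_) (pairSum-shift (w W u) (w W v) M)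
            (+-monoˡ-< (M + M) (leftFree i i≡0 u v u≢v nonadjacent))

    lowerFirst : ∀ {k} (W : Witness G (suc k)) → LeftFree W → ℚ → Witness G (suc k)
    lowerFirst W leftFree c = record
      { w = w W ; w-pos = w-pos W ; a = a′ ; b = b W ; a≤b = a′≤b ; ordered = ordered′ ; edge = edge′ }
      where
      a′ : Fin (suc _) → ℚ
      a′ zero    = a W zero ⊓ c
      a′ (suc i) = a W (suc i)
      a′≤a : ∀ i → a′ i ≤ a W i
      a′≤a zero    = p⊓q≤p (a W zero) c
      a′≤a (suc i) = ≤-refl
      a′≤b : ∀ i → a′ i ≤ b W i
      a′≤b i = ≤-trans (a′≤a i) (a≤b W i)
      ordered′ : ∀ i j → toℕ j ≡ suc (toℕ i) → b W i < a′ j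
      ordered′ i (suc j) j≡1+i = ordered W i (suc j) j≡1+i
      edge′ : ∀ u v → u ≢ v → (adj G u v ≡ true) ⇔ InIntervals a′ (b W) (w W u + w W v)
      edge′ u v u≢v = mk⇔
        (λ adjacent → let i , a≤s , s≤b = to (edge W u v u≢v) adjacent in i , ≤-trans (a′≤a i) a≤s , s≤b)
        λ { (zero , _ , s≤b) → ¬-not λ nonadjacent → <-irrefl refl (<-≤-trans (leftFree zero refl u v u≢v nonadjacent) s≤b)
          ; (suc i , a≤s , s≤b) → from (edge W u v u≢v) (suc i , a≤s , s≤b) }

    lowerFirst-a₁≤ : ∀ {k} (W : Witness G (suc k)) leftFree c → a (lowerFirst W leftFree c) zero ≤ c
    lowerFirst-a₁≤ W _ c = p⊓q≤q (a W zero) c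

    raiseLast : ∀ {k} (W : Witness G (suc k)) → RightFree W → ℚ → Witness G (suc k)
    raiseLast {k} W rightFree c = record
      { w = w W ; w-pos = w-pos W ; a = a W ; b = b′ ; a≤b = λ i → ≤-trans (a≤b W i) (b≤b′ i) ; ordered = ordered′ ; edge = edge′ }
      where
      last = Fin.fromℕ k
      b′ = V.updateAt (b W) last (_⊔ c)
      b′-last : b′ last ≡ b W last ⊔ c
      b′-last = Vₚ.updateAt-updates last (b W)
      b′-other : ∀ {i} → i ≢ last → b′ i ≡ b W i
      b′-other {i} i≢last = Vₚ.updateAt-minimal i last (b W) i≢last
      b≤b′ : ∀ i → b W i ≤ b′ i
      b≤b′ i with i Fin.≟ last
      ... | yes refl = ≤-trans (p≤p⊔q (b W last) c) (≤-reflexive (≡.sym b′-last))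
      ... | no i≢last = ≤-reflexive (≡.sym (b′-other i≢last))
      ordered′ : ∀ i j → toℕ j ≡ suc (toℕ i) → b′ i < a W j
      ordered′ i j j≡1+i = subst (_< a W j) (≡.sym (b′-other i≢last)) (ordered W i j j≡1+i)
        where
        i≢last : i ≢ last
        i≢last refl = ℕₚ.<-irrefl (≡.trans j≡1+i (cong suc (Finₚ.toℕ-fromℕ k))) (Finₚ.toℕ<n j)
      edge′ : ∀ u v → u ≢ v → (adj G u v ≡ true) ⇔ InIntervals (a W) b′ (w W u + w W v)
      edge′ u v u≢v = mk⇔
        (λ adjacent → let i , a≤s , s≤b = to (edge W u v u≢v) adjacent in i , a≤s , ≤-trans s≤b (b≤b′ i))
        λ (i , a≤s , s≤b′) → case i Fin.≟ last of λ where
          (yes refl) → ¬-not λ nonadjacent →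
            <-irrefl refl (<-≤-trans (rightFree last (cong suc (Finₚ.toℕ-fromℕ k)) u v u≢v nonadjacent) a≤s)
          (no i≢last) → from (edge W u v u≢v) (i , a≤s , subst (_ ≤_) (b′-other i≢last) s≤b′)

    raiseLast-≤bₖ : ∀ {k} (W : Witness G (suc k)) rightFree c → c ≤ b (raiseLast W rightFree c) (Fin.fromℕ k)
    raiseLast-≤bₖ {k} W _ c = ≤-trans (p≤q⊔p (b W (Fin.fromℕ k)) c) (≤-reflexive (≡.sym (Vₚ.updateAt-updates (Fin.fromℕ k) (b W))))

    pointBelow : ∀ {k} → Witness G (suc k) → ℚ
    pointBelow W = a W zero ⊓ 0ℚ - 1ℚ

    pointBelow<a₁ : ∀ {k} (W : Witness G (suc k)) → pointBelow W < a W zero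
    pointBelow<a₁ W = <-≤-trans (p-1<p _) (p⊓q≤p (a W zero) 0ℚ)

    pointBelow<pairSum : ∀ {k} (W : Witness G (suc k)) u v → pointBelow W < w W u + w W v
    pointBelow<pairSum W u v = <-trans (<-≤-trans (p-1<p _) (p⊓q≤q (a W zero) 0ℚ)) (pairSum-pos W u v)

    prepend : ∀ {k} → Witness G (suc k) → Witness G (suc (suc k))
    prepend W = record
      { w = w W ; w-pos = w-pos W ; a = a′ ; b = b′ ; a≤b = a′≤b′ ; ordered = ordered′ ; edge = edge′ }
      where
      a′ b′ : Fin (suc (suc _)) → ℚ
      a′ zero    = pointBelow W
      a′ (suc i) = a W i
      b′ zero    = pointBelow W
      b′ (suc i) = b W i
      a′≤b′ : ∀ i → a′ i ≤ b′ i
      a′≤b′ zero    = ≤-refl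
      a′≤b′ (suc i) = a≤b W i
      ordered′ : ∀ i j → toℕ j ≡ suc (toℕ i) → b′ i < a′ j
      ordered′ zero    (suc zero) refl  = pointBelow<a₁ W
      ordered′ (suc i) (suc j)    j≡1+i = ordered W i j (ℕₚ.suc-injective j≡1+i)
      edge′ : ∀ u v → u ≢ v → (adj G u v ≡ true) ⇔ InIntervals a′ b′ (w W u + w W v)
      edge′ u v u≢v = mk⇔
        (λ adjacent → let i , a≤s , s≤b = to (edge W u v u≢v) adjacent in suc i , a≤s , s≤b)
        λ { (zero , _ , s≤c) → ⊥-elim (<-irrefl refl (<-≤-trans (pointBelow<pairSum W u v) s≤c))
          ; (suc i , a≤s , s≤b) → from (edge W u v u≢v) (i , a≤s , s≤b) }

    prepend-leftFree : ∀ {k} (W : Witness G (suc k)) → LeftFree (prepend W)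
    prepend-leftFree W zero refl u v _ _ = pointBelow<pairSum W u v

    leftFree-extend : ∀ {k} (W : Witness G (suc k)) → LeftFree W → Witness (addUniversal G) (suc k)
    leftFree-extend W leftFree = universal-extend W₂ 1ℚ (positive⁻¹ 1ℚ) covered
      where
      B = proj₁ (boundedAbove (w W))
      M = (1ℚ + B - b W zero) ⊔ 0ℚ
      M≥0 = p≤q⊔p (1ℚ + B - b W zero) 0ℚ
      W₁ = shift W M M≥0
      leftFree₁ = shift-leftFree W M M≥0 leftFree
      W₂ = lowerFirst W₁ leftFree₁ 0ℚ
      covered : ∀ u → InIntervals (a W₂) (b W₂) (1ℚ + w W₂ u)
      covered u = zero , ≤-trans (lowerFirst-a₁≤ W₁ leftFree₁ 0ℚ) (<⇒≤ (+-mono-< (positive⁻¹ 1ℚ) (w-pos W₁ u))) , (begin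
        1ℚ + (w W u + M)                      ≤⟨ +-monoʳ-≤ 1ℚ (+-monoˡ-≤ M (proj₂ (boundedAbove (w W)) u)) ⟩
        1ℚ + (B + M)                          ≡⟨ solve 3 (λ b B M → con 1ℚ :+ (B :+ M) := b :+ ((con 1ℚ :+ B :- b) :+ M)) refl (b W zero) B M ⟩
        b W zero + ((1ℚ + B - b W zero) + M)  ≤⟨ +-monoʳ-≤ (b W zero) (+-monoˡ-≤ M (p≤p⊔q (1ℚ + B - b W zero) 0ℚ)) ⟩
        b W zero + (M + M)                    ∎)
        where open ≤-Reasoning

    rightFree-extend : ∀ {k} (W : Witness G (suc k)) → RightFree W → Witness (addUniversal G) (suc k)
    rightFree-extend {k} W rightFree = universal-extend W₂ t t>0 covered
      where
      last = Fin.fromℕ k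
      t = a W last ⊔ 1ℚ
      t>0 = <-≤-trans (positive⁻¹ 1ℚ) (p≤q⊔p (a W last) 1ℚ)
      B = proj₁ (boundedAbove (w W))
      W₂ = raiseLast W rightFree (t + B)
      covered : ∀ u → InIntervals (a W₂) (b W₂) (t + w W₂ u)
      covered u = last
        , ≤-trans (p≤p⊔q (a W last) 1ℚ) (<⇒≤ (p<p+q t (w-pos W u)))
        , ≤-trans (+-monoʳ-≤ t (proj₂ (boundedAbove (w W)) u)) (raiseLast-≤bₖ W rightFree (t + B))

open import Data.Nat using (ℕ; zero; suc; _≤_; _<_; s≤s; z≤n)
import Data.Nat.Properties as ℕₚ
open import Data.Product using (Σ; ∃; _×_; _,_)
open import Data.Sum using (inj₁; inj₂)
open import Function using (_∘_)
open import Relation.Binary.PropositionalEquality using (refl)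
open import Relation.Nullary using (¬_; Dec; yes; no)

open Witnesses using (restrict; leftFree-extend; rightFree-extend; prepend; prepend-leftFree; module WitnessEncoding)

starNumber-≤-suc : ∀ {n} (H : Graph n) k → (∀ m → 1 ≤ m → m < suc k → ¬ StarPCG H m) →
  StarPCG H (suc (suc k)) → ∃ λ m → StarNumber H m × m ≤ suc (suc k)
starNumber-≤-suc H k minimal W = by-decision (WitnessEncoding.starPCG? H (suc k))
  where
  -- Matching on the decision in a helper instead of with-abstracting over it keeps Agda from
  -- normalising the decision procedure while checking.
  by-decision : Dec (StarPCG H (suc k)) → ∃ λ m → StarNumber H m × m ≤ suc (suc k)
  by-decision (yes W′) = suc k , (s≤s z≤n , W′ , minimal) , ℕₚ.n≤1+n (suc k)
  by-decision (no ¬W′) = suc (suc k) , (s≤s z≤n , W , minimal′) , ℕₚ.≤-refl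
    where
    minimal′ : ∀ m → 1 ≤ m → m < suc (suc k) → ¬ StarPCG H m
    minimal′ m 1≤m m<k+2 with ℕₚ.m<1+n⇒m<n∨m≡n m<k+2
    ... | inj₁ m<k+1 = minimal m 1≤m m<k+1
    ... | inj₂ refl  = ¬W′

theorem3 : ∀ (n : ℕ) (G : Graph n) (k : ℕ) → StarNumber G k →
    ((Σ (Witness G k) Free) → StarNumber (addUniversal G) k)
    × (¬ (Σ (Witness G k) Free) → ∃ λ m → StarNumber (addUniversal G) m × m ≤ suc k)
theorem3 n G zero    (() , _)
theorem3 n G (suc k) (_ , W , minimal) = free-case , general-case
  where
  minimal′ : ∀ m → 1 ≤ m → m < suc k → ¬ StarPCG (addUniversal G) m
  minimal′ m 1≤m m<k = minimal m 1≤m m<k ∘ restrict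
  free-case : Σ (Witness G (suc k)) Free → StarNumber (addUniversal G) (suc k)
  free-case (W , inj₁ leftFree)  = s≤s z≤n , leftFree-extend W leftFree , minimal′
  free-case (W , inj₂ rightFree) = s≤s z≤n , rightFree-extend W rightFree , minimal′
  -- The bound γ(G') ≤ k + 1 holds whether or not G has a free witness.
  general-case : ¬ (Σ (Witness G (suc k)) Free) → ∃ λ m → StarNumber (addUniversal G) m × m ≤ suc (suc k)
  general-case _ = starNumber-≤-suc (addUniversal G) k minimal′ (leftFree-extend (prepend W) (prepend-leftFree W))
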